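{- Let $k$ be odd, let $n = 2m$ be even with $m \ge 1$, and suppose $p = nk+1$ is prime with $p > n^4 + 5$. Let $X_0 \subseteq \mathbb{F}_p^\times$ be the multiplicative subgroup of index $n$ and $X_0, X_1, \ldots, X_{n-1}$ its cosets, indexed as in the context. Then the cosets $X_0,\dots,X_{n-1}$ form neither an $m$-color Directed Ramsey algebra nor an $m$-color Directed Anti-Ramsey algebra over $\mathbb{F}_p$.
   Context: Let $k$ be odd and $n=2m$ even with $p = nk+1$ prime. Let $g$ be a primitive root modulo $p$, let $X_0=\{g^{\alpha n} : 0\le \alpha<k\}$ (the multiplicative subgroup of $\mathbb{F}_p^\times$ of index $n$), and for $1\le i<n$ let $X_i=\{g^{\alpha n+i}: 0\le \alpha<k\}$; indices are taken modulo $n$. Sumsets are $A+B=\{a+b : a\in A, b\in B\}$. The cosets form an $m$-color (prime field) Directed Ramsey algebra if: (1) for all $i$, $X_i+X_i=\bigcup_{j\ne i}X_j$; (2) for all $i$, $X_i+X_{i+m}=\{0\}\cup\bigcup_{j\notin\{i,i+m\}}X_j$; (3) for all $i,j$ with $j\ne i$ and $j\ne i+m$, $X_i+X_j=\mathbb{F}_p^\times$. The cosets form an $m$-color (prime field) Directed Anti-Ramsey algebra if: (1) for all $i$, $X_i+X_i=\bigcup_{j\ne i+m}X_j$; (2) for all $i$, $X_i+X_{i+m}=\mathbb{F}_p$; (3) for all $i,j$ with $j\ne i$ and $j\ne i+m$, $X_i+X_j=\mathbb{F}_p^\times$. -}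

module Defs where

open import Data.Nat using (ℕ; zero; suc; _+_; _*_; _^_; _≤_; _<_; _%_)
open import Data.Product using (Σ; ∃; ∃-syntax; _×_)
open import Data.Sum using (_⊎_)
open import Relation.Binary.PropositionalEquality using (_≡_; _≢_)
open import Function.Bundles using (_⇔_)

-- Remainder of a modulo b; only ever used with b ≥ 1 (b = n ≥ 2 or b = p prime).
modN : ℕ → ℕ → ℕ
modN a zero    = a
modN a (suc b) = a % suc b

-- Elements of 𝔽_p are represented by the residues 0 ≤ x < p;
-- arithmetic is ℕ arithmetic followed by reduction mod p.

IsPrimitiveRoot : ℕ → ℕ → Set
IsPrimitiveRoot p g = g < p × (∀ x → 1 ≤ x → x < p → ∃[ e ] modN (g ^ e) p ≡ x)

Coset : (p g n k : ℕ) → ℕ → ℕ → Set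
Coset p g n k i x = ∃[ α ] α < k × x ≡ modN (g ^ (α * n + modN i n)) p

SumSet : ℕ → (ℕ → Set) → (ℕ → Set) → ℕ → Set
SumSet p A B x = ∃[ a ] ∃[ b ] A a × B b × x ≡ modN (a + b) p

DirectedRamsey : (p g m k : ℕ) → Set
DirectedRamsey p g m k =
  ∀ i → i < n →
    (∀ x → x < p → SumSet p (X i) (X i) x ⇔ (∃[ j ] j < n × j ≢ i × X j x))
  × (∀ x → x < p → SumSet p (X i) (X (i + m)) x
                     ⇔ (x ≡ 0 ⊎ ∃[ j ] j < n × j ≢ i × j ≢ modN (i + m) n × X j x))
  × (∀ j → j < n → j ≢ i → j ≢ modN (i + m) n →
       ∀ x → x < p → SumSet p (X i) (X j) x ⇔ (1 ≤ x))
  where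
  n = 2 * m
  X = Coset p g n k

DirectedAntiRamsey : (p g m k : ℕ) → Set
DirectedAntiRamsey p g m k =
  ∀ i → i < n →
    (∀ x → x < p → SumSet p (X i) (X i) x ⇔ (∃[ j ] j < n × j ≢ modN (i + m) n × X j x))
  × (∀ x → x < p → SumSet p (X i) (X (i + m)) x)
  × (∀ j → j < n → j ≢ i → j ≢ modN (i + m) n →
       ∀ x → x < p → SumSet p (X i) (X j) x ⇔ (1 ≤ x))
  where
  n = 2 * m
  X = Coset p g n k

-- Condition (1) of either notion forces X₀ + X₀ to avoid one coset: X₀ itself
-- (Ramsey) or X_m (Anti-Ramsey).  We prove instead that X₀ + X₀ meets EVERY
-- coset X_r.  Writing N = #{(y,t) ∈ X₀² : t + y ∈ X_r}, an elementary
-- second-moment argument shows, for any set H ⊆ 𝔽_p^× of size k and any set C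
-- of size k with H·C ⊆ C (here H = X₀, C = X_r),
--     (pN − k³)² ≤ k(p − k) · pk(p − k).                              (★)
-- It combines Cauchy–Schwarz with the invariance of sums over 𝔽_p under the
-- affine bijections z ↦ u + dz (d ≠ 0).  When p = nk + 1 > n⁴ + 5 the right-hand
-- side of (★) is smaller than k⁶, so N ≠ 0.
module Submission where

module FiniteSums where

  open import Data.Nat as ℕ using (ℕ; zero; suc; z≤n; s≤s)
  import Data.Nat.Properties as ℕP
  open import Data.Fin using (Fin; toℕ; fromℕ<; punchOut)
  import Data.Fin.Properties as FinP
  open import Data.Fin.Permutation using (Permutation; permutation)
  open import Data.Integer as ℤ using (ℤ; +_; 0ℤ; 1ℤ)
  import Data.Integer.Properties as ℤP
  open import Algebra.Properties.Semiring.Sum ℤP.+-*-semiring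
    using (sum; sum-cong-≗; ∑-distrib-+; ∑-comm; ∑-permute; *-distribˡ-sum; *-distribʳ-sum)
  open import Data.Product using (∃; ∃-syntax; _×_; _,_; proj₁; proj₂)
  open import Function.Definitions using (Injective)
  open import Relation.Binary.PropositionalEquality
  open import Relation.Nullary using (¬_; yes; no)
  open import Data.Empty using (⊥-elim)

  -- Sums are kept abstract, so that they are only manipulated through the lemmas below.
  abstract

    -- Sum n f = f 0 + ⋯ + f (n − 1), the library sum of f restricted to Fin n.
    -- By definition Sum (suc n) f = f 0 + Sum n (f ∘ suc).
    Sum : ℕ → (ℕ → ℤ) → ℤ
    Sum n f = sum {n} (λ i → f (toℕ i))

    Sum-cong : ∀ n {f g : ℕ → ℤ} → (∀ x → x ℕ.< n → f x ≡ g x) → Sum n f ≡ Sum n g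
    Sum-cong n f≗g = sum-cong-≗ {n} (λ i → f≗g (toℕ i) (FinP.toℕ<n i))

    Sum-cong₂ : ∀ n {f g : ℕ → ℕ → ℤ} → (∀ x y → x ℕ.< n → y ℕ.< n → f x y ≡ g x y) →
                Sum n (λ x → Sum n (f x)) ≡ Sum n (λ x → Sum n (g x))
    Sum-cong₂ n f≗g = Sum-cong n (λ x x<n → Sum-cong n (λ y y<n → f≗g x y x<n y<n))

    Sum-+ : ∀ n (f g : ℕ → ℤ) → Sum n (λ x → f x ℤ.+ g x) ≡ Sum n f ℤ.+ Sum n g
    Sum-+ n f g = ∑-distrib-+ {n} (λ i → f (toℕ i)) (λ i → g (toℕ i))

    Sum-*ˡ : ∀ n c (f : ℕ → ℤ) → Sum n (λ x → c ℤ.* f x) ≡ c ℤ.* Sum n f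
    Sum-*ˡ n c f = sym (*-distribˡ-sum {n} c (λ i → f (toℕ i)))

    Sum-*ʳ : ∀ n c (f : ℕ → ℤ) → Sum n (λ x → f x ℤ.* c) ≡ Sum n f ℤ.* c
    Sum-*ʳ n c f = sym (*-distribʳ-sum {n} c (λ i → f (toℕ i)))

    Sum-lin : ∀ n a b (f g : ℕ → ℤ) →
              Sum n (λ x → a ℤ.* f x ℤ.+ b ℤ.* g x) ≡ a ℤ.* Sum n f ℤ.+ b ℤ.* Sum n g
    Sum-lin n a b f g = trans (Sum-+ n (λ x → a ℤ.* f x) (λ x → b ℤ.* g x)) (cong₂ ℤ._+_ (Sum-*ˡ n a f) (Sum-*ˡ n b g))

    Sum-product : ∀ n (f g : ℕ → ℤ) → Sum n (λ y → Sum n (λ z → f y ℤ.* g z)) ≡ Sum n f ℤ.* Sum n g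
    Sum-product n f g = trans (Sum-cong n (λ y _ → Sum-*ˡ n (f y) g)) (Sum-*ʳ n (Sum n g) f)

    Sum-comm : ∀ m n (f : ℕ → ℕ → ℤ) →
               Sum m (λ x → Sum n (λ y → f x y)) ≡ Sum n (λ y → Sum m (λ x → f x y))
    Sum-comm m n f = ∑-comm {m} {n} (λ i j → f (toℕ i) (toℕ j))

    Sum-const : ∀ n c → Sum n (λ _ → c) ≡ + n ℤ.* c
    Sum-const zero    c = sym (ℤP.*-zeroˡ c)
    Sum-const (suc n) c = begin
      c ℤ.+ Sum n (λ _ → c)   ≡⟨ cong (ℤ._+_ c) (Sum-const n c) ⟩
      c ℤ.+ + n ℤ.* c         ≡⟨ cong (λ z → z ℤ.+ + n ℤ.* c) (ℤP.*-identityˡ c) ⟨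
      1ℤ ℤ.* c ℤ.+ + n ℤ.* c  ≡⟨ ℤP.*-distribʳ-+ c 1ℤ (+ n) ⟨
      + suc n ℤ.* c           ∎
      where open ≡-Reasoning

    Sum-mono : ∀ n {f g : ℕ → ℤ} → (∀ x → x ℕ.< n → f x ℤ.≤ g x) → Sum n f ℤ.≤ Sum n g
    Sum-mono zero    f≤g = ℤP.≤-refl
    Sum-mono (suc n) f≤g = ℤP.+-mono-≤ (f≤g 0 (s≤s z≤n)) (Sum-mono n (λ x x<n → f≤g (suc x) (s≤s x<n)))

    Sum-nonneg : ∀ n (f : ℕ → ℤ) → (∀ x → x ℕ.< n → 0ℤ ℤ.≤ f x) → 0ℤ ℤ.≤ Sum n f
    Sum-nonneg n f 0≤f = subst (ℤ._≤ Sum n f) (trans (Sum-const n 0ℤ) (ℤP.*-zeroʳ (+ n))) (Sum-mono n 0≤f)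

    -- A nonzero sum has a nonzero term; this is how witnesses are extracted from counts.
    Sum≢0⇒term≢0 : ∀ n (f : ℕ → ℤ) → ¬ (Sum n f ≡ 0ℤ) → ∃[ x ] x ℕ.< n × ¬ (f x ≡ 0ℤ)
    Sum≢0⇒term≢0 zero    f Σ≢0 = ⊥-elim (Σ≢0 refl)
    Sum≢0⇒term≢0 (suc n) f Σ≢0 with f 0 ℤP.≟ 0ℤ
    ... | no  f0≢0 = 0 , s≤s z≤n , f0≢0
    ... | yes f0≡0 with Sum≢0⇒term≢0 n (λ x → f (suc x)) (λ Σ≡0 → Σ≢0 (cong₂ ℤ._+_ f0≡0 Σ≡0))
    ...   | x , x<n , fx≢0 = suc x , s≤s x<n , fx≢0

    δ : ℕ → ℕ → ℤ
    δ zero    zero    = 1ℤ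
    δ zero    (suc c) = 0ℤ
    δ (suc x) zero    = 0ℤ
    δ (suc x) (suc c) = δ x c

    δ-diag : ∀ x → δ x x ≡ 1ℤ
    δ-diag zero    = refl
    δ-diag (suc x) = δ-diag x

    δ-off : ∀ x c → ¬ (x ≡ c) → δ x c ≡ 0ℤ
    δ-off zero    zero    x≢c = ⊥-elim (x≢c refl)
    δ-off zero    (suc c) x≢c = refl
    δ-off (suc x) zero    x≢c = refl
    δ-off (suc x) (suc c) x≢c = δ-off x c (λ x≡c → x≢c (cong suc x≡c))

    δ≢0⇒≡ : ∀ x c → ¬ (δ x c ≡ 0ℤ) → x ≡ c
    δ≢0⇒≡ x c δ≢0 with x ℕP.≟ c
    ... | yes x≡c = x≡c
    ... | no  x≢c = ⊥-elim (δ≢0 (δ-off x c x≢c))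

    Sum-δ : ∀ n c (f : ℕ → ℤ) → c ℕ.< n → Sum n (λ x → δ x c ℤ.* f x) ≡ f c
    Sum-δ (suc n) zero    f _         = begin
      1ℤ ℤ.* f 0 ℤ.+ Sum n (λ _ → 0ℤ ℤ.* f 0)  ≡⟨ cong₂ ℤ._+_ (ℤP.*-identityˡ (f 0)) (Sum-const n 0ℤ) ⟩
      f 0 ℤ.+ + n ℤ.* 0ℤ                       ≡⟨ cong (ℤ._+_ (f 0)) (ℤP.*-zeroʳ (+ n)) ⟩
      f 0 ℤ.+ 0ℤ                               ≡⟨ ℤP.+-identityʳ (f 0) ⟩
      f 0                                      ∎
      where open ≡-Reasoning
    Sum-δ (suc n) (suc c) f (s≤s c<n) = trans (ℤP.+-identityˡ _) (Sum-δ n c (λ x → f (suc x)) c<n)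

    injective⇒onto : ∀ {n} (h : Fin n → Fin n) → Injective _≡_ _≡_ h → ∀ z → ∃ λ i → h i ≡ z
    injective⇒onto {suc n} h h-inj z with FinP.any? (λ i → h i FinP.≟ z)
    ... | yes hit = hit
    ... | no  miss = ⊥-elim (ℕP.<-irrefl refl (FinP.injective⇒≤ h′-inj))
      where
      -- Omitting the value z, h becomes an injection Fin (suc n) → Fin n.
      h′ : Fin (suc n) → Fin n
      h′ i = punchOut {i = z} {j = h i} (λ z≡hi → miss (i , sym z≡hi))
      h′-inj : Injective _≡_ _≡_ h′
      h′-inj {i} {j} eq = h-inj (FinP.punchOut-injective (λ e → miss (i , sym e)) (λ e → miss (j , sym e)) eq)

    Sum-reindex : ∀ n (σ : ℕ → ℕ) → (∀ x → x ℕ.< n → σ x ℕ.< n) →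
                  (∀ x y → x ℕ.< n → y ℕ.< n → σ x ≡ σ y → x ≡ y) →
                  ∀ f → Sum n (λ x → f (σ x)) ≡ Sum n f
    Sum-reindex n σ σ<n σ-inj f = begin
      Sum n (λ x → f (σ x))          ≡⟨ sum-cong-≗ {n} (λ i → cong f (sym (FinP.toℕ-fromℕ< _))) ⟩
      sum {n} (λ i → F (σ̂ i))        ≡⟨ ∑-permute F π ⟨
      Sum n f                        ∎
      where
      open ≡-Reasoning
      F : Fin n → ℤ
      F i = f (toℕ i)
      σ̂ : Fin n → Fin n
      σ̂ i = fromℕ< (σ<n (toℕ i) (FinP.toℕ<n i))
      σ̂-inj : Injective _≡_ _≡_ σ̂
      σ̂-inj {i} {j} eq = FinP.toℕ-injective (σ-inj _ _ (FinP.toℕ<n i) (FinP.toℕ<n j)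
        (trans (sym (FinP.toℕ-fromℕ< _)) (trans (cong toℕ eq) (FinP.toℕ-fromℕ< _))))
      π : Permutation n n
      π = permutation σ̂ (λ z → proj₁ (injective⇒onto σ̂ σ̂-inj z))
                        (λ z → proj₂ (injective⇒onto σ̂ σ̂-inj z))
                        (λ x → σ̂-inj (proj₂ (injective⇒onto σ̂ σ̂-inj (σ̂ x))))

module Residues where

  open import Data.Nat using (ℕ; zero; suc; _+_; _*_; _∸_; _%_; _/_; _≤_; _<_; NonZero)
  open import Data.Nat.Properties
  open import Data.Nat.DivMod
  open import Data.Nat.Divisibility
  open import Data.Nat.Primality using (Prime; euclidsLemma)
  open import Data.Integer using (ℤ)
  open import Data.Sum using (inj₁; inj₂)
  open import Relation.Binary.PropositionalEquality
  open import Relation.Nullary using (¬_)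
  open import Data.Empty using (⊥-elim)
  open FiniteSums using (Sum; Sum-cong; Sum-reindex)

  module _ (P : ℕ) .{{_ : NonZero P}} where

    %-+ʳ : ∀ a b → (a + b % P) % P ≡ (a + b) % P
    %-+ʳ a b = trans (%-distribˡ-+ a (b % P) P)
                     (trans (cong (λ z → (a % P + z) % P) (m%n%n≡m%n b P)) (sym (%-distribˡ-+ a b P)))

    %-+ˡ : ∀ a b → (a % P + b) % P ≡ (a + b) % P
    %-+ˡ a b = trans (cong (_% P) (+-comm (a % P) b)) (trans (%-+ʳ b a) (cong (_% P) (+-comm b a)))

    %-*ʳ : ∀ a b → (a * (b % P)) % P ≡ (a * b) % P
    %-*ʳ a b = trans (%-distribˡ-* a (b % P) P)
                     (trans (cong (λ z → ((a % P) * z) % P) (m%n%n≡m%n b P)) (sym (%-distribˡ-* a b P)))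

    %-*ˡ : ∀ a b → ((a % P) * b) % P ≡ (a * b) % P
    %-*ˡ a b = trans (cong (_% P) (*-comm (a % P) b)) (trans (%-*ʳ b a) (cong (_% P) (*-comm b a)))

  module _ (q : ℕ) where

    private
      p : ℕ
      p = suc q

    %≡⇒∣∸ : ∀ a b → a % p ≡ b % p → a ≤ b → p ∣ b ∸ a
    %≡⇒∣∸ a b a≡b _ = divides (b / p ∸ a / p) (begin
      b ∸ a                                    ≡⟨ cong₂ _∸_ (m≡m%n+[m/n]*n b p) (m≡m%n+[m/n]*n a p) ⟩
      (b % p + b / p * p) ∸ (a % p + a / p * p) ≡⟨ cong (λ z → (b % p + b / p * p) ∸ (z + a / p * p)) a≡b ⟩
      (b % p + b / p * p) ∸ (b % p + a / p * p) ≡⟨ [m+n]∸[m+o]≡n∸o (b % p) _ _ ⟩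
      b / p * p ∸ a / p * p                    ≡⟨ *-distribʳ-∸ p (b / p) (a / p) ⟨
      (b / p ∸ a / p) * p                      ∎)
      where open ≡-Reasoning

    ∣∸⇒%≡ : ∀ a b → a ≤ b → p ∣ b ∸ a → a % p ≡ b % p
    ∣∸⇒%≡ a b a≤b p∣b∸a = trans (sym (%-remove-+ʳ a p∣b∸a)) (cong (_% p) (m+[n∸m]≡n a≤b))

    ∣∧<⇒≡0 : ∀ e → p ∣ e → e < p → e ≡ 0
    ∣∧<⇒≡0 zero    _   _   = refl
    ∣∧<⇒≡0 (suc e) p∣e e<p = ⊥-elim (<-irrefl refl (≤-trans e<p (∣⇒≤ p∣e)))

    -- Congruence is symmetric, so cancellation laws may assume a ≤ b.
    wlog-≤ : ∀ (R : ℕ → ℕ → Set) → (∀ a b → R a b → R b a) → (∀ a b → a ≤ b → R a b) → ∀ a b → R a b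
    wlog-≤ R R-sym R-≤ a b with ≤-total a b
    ... | inj₁ a≤b = R-≤ a b a≤b
    ... | inj₂ b≤a = R-sym b a (R-≤ b a b≤a)

    +-cancelˡ-% : ∀ u a b → (u + a) % p ≡ (u + b) % p → a % p ≡ b % p
    +-cancelˡ-% u = wlog-≤ (λ a b → (u + a) % p ≡ (u + b) % p → a % p ≡ b % p)
      (λ a b cancel eq → sym (cancel (sym eq)))
      (λ a b a≤b eq → ∣∸⇒%≡ a b a≤b
         (subst (p ∣_) ([m+n]∸[m+o]≡n∸o u b a) (%≡⇒∣∸ (u + a) (u + b) eq (+-monoʳ-≤ u a≤b))))

    Sum-shift : ∀ u (f : ℕ → ℤ) → Sum p (λ y → f ((u + y) % p)) ≡ Sum p f
    Sum-shift u = Sum-reindex p (λ y → (u + y) % p) (λ y _ → m%n<n (u + y) p)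
      (λ x y x<p y<p eq → trans (sym (m<n⇒m%n≡m x<p)) (trans (+-cancelˡ-% u x y eq) (m<n⇒m%n≡m y<p)))

    module _ (prime : Prime p) where

      *-cancelˡ-% : ∀ a x y → ¬ (a % p ≡ 0) → (a * x) % p ≡ (a * y) % p → x % p ≡ y % p
      *-cancelˡ-% a = wlog-≤ (λ x y → ¬ (a % p ≡ 0) → (a * x) % p ≡ (a * y) % p → x % p ≡ y % p)
        (λ x y cancel a≢0 eq → sym (cancel a≢0 (sym eq)))
        (λ x y x≤y a≢0 eq → ∣∸⇒%≡ x y x≤y (p∣y∸x x y x≤y a≢0 eq))
        where
        p∣y∸x : ∀ x y → x ≤ y → ¬ (a % p ≡ 0) → (a * x) % p ≡ (a * y) % p → p ∣ y ∸ x
        p∣y∸x x y x≤y a≢0 eq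
          with euclidsLemma a (y ∸ x) prime
                 (subst (p ∣_) (sym (*-distribˡ-∸ a y x)) (%≡⇒∣∸ (a * x) (a * y) eq (*-monoʳ-≤ a x≤y)))
        ... | inj₁ p∣a   = ⊥-elim (a≢0 (n∣m⇒m%n≡0 a p p∣a))
        ... | inj₂ p∣y∸x = p∣y∸x

      Sum-affine : ∀ u d → ¬ (d % p ≡ 0) → ∀ (f : ℕ → ℤ) → Sum p (λ h → f ((u + h * d) % p)) ≡ Sum p f
      Sum-affine u d d≢0 = Sum-reindex p (λ h → (u + h * d) % p) (λ h _ → m%n<n (u + h * d) p)
        (λ x y x<p y<p eq → trans (sym (m<n⇒m%n≡m x<p))
          (trans (*-cancelˡ-% d x y d≢0
                   (trans (cong (_% p) (*-comm d x))
                     (trans (+-cancelˡ-% u (x * d) (y * d) eq) (cong (_% p) (*-comm y d)))))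
                 (m<n⇒m%n≡m y<p)))

      Sum-dilate : ∀ d → ¬ (d % p ≡ 0) → ∀ (f : ℕ → ℤ) → Sum p (λ y → f ((d * y) % p)) ≡ Sum p f
      Sum-dilate d d≢0 f = trans (Sum-cong p (λ y _ → cong (λ z → f (z % p)) (*-comm d y)))
                                 (Sum-affine 0 d d≢0 f)

-- Powers of a primitive root g modulo a prime p = q + 1.  The map e ↦ g^e mod p
-- has exact period q (Fermat's little theorem together with minimality), so it is
-- injective on exponents below q.
module PrimitiveRoot where

  open import Data.Nat using (ℕ; zero; suc; pred; z≤n; s≤s; _+_; _*_; _∸_; _%_; _/_; _≤_; _<_; _^_; NonZero; ≢-nonZero)
  open import Data.Nat.Properties
  open import Data.Nat.DivMod
  open import Data.Nat.Divisibility
  open import Data.Nat.Primality using (Prime; euclidsLemma)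
  open import Data.Fin using (Fin; toℕ; fromℕ<)
  import Data.Fin.Properties as FinP
  open import Data.Product using (∃-syntax; _,_; proj₁; proj₂)
  open import Data.Sum using (inj₁; inj₂)
  open import Relation.Binary.PropositionalEquality
  open import Relation.Nullary using (¬_)
  open import Data.Empty using (⊥-elim)
  open import Relation.Binary.Definitions using (tri<; tri≈; tri>)
  open import Function.Definitions using (Injective)
  open Residues using (∣∧<⇒≡0; *-cancelˡ-%)

  module Powers (q g : ℕ) (prime : Prime (suc q)) (2<p : 2 < suc q) (g<p : g < suc q)
           (onto : ∀ x → 1 ≤ x → x < suc q → ∃[ e ] (g ^ e) % suc q ≡ x) where

    p : ℕ
    p = suc q

    G : ℕ → ℕ
    G e = g ^ e % p

    G<p : ∀ e → G e < p
    G<p e = m%n<n (g ^ e) p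

    G-% : ∀ e → G e % p ≡ G e
    G-% e = m%n%n≡m%n (g ^ e) p

    G-+ : ∀ e f → G (e + f) ≡ (G e * G f) % p
    G-+ e f = trans (cong (_% p) (^-distribˡ-+-* g e f)) (%-distribˡ-* (g ^ e) (g ^ f) p)

    1%p≡1 : 1 % p ≡ 1
    1%p≡1 = m<n⇒m%n≡m (≤-trans (s≤s (s≤s z≤n)) 2<p)

    -- g ≠ 0, since otherwise the power 2 would not be reached.
    g≢0 : ¬ (g ≡ 0)
    g≢0 refl with onto 2 (s≤s z≤n) 2<p
    ... | zero  , 1≡2 = 1≢2 (trans (sym 1%p≡1) 1≡2)
      where 1≢2 : ¬ (1 ≡ 2)
            1≢2 ()
    ... | suc e , 0≡2 = 0≢2 0≡2
      where 0≢2 : ¬ (0 ≡ 2)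
            0≢2 ()

    p∤g^ : ∀ e → ¬ (p ∣ g ^ e)
    p∤g^ zero    p∣1 = 3≰1 (≤-trans 2<p (∣⇒≤ p∣1))
      where 3≰1 : ¬ (3 ≤ 1)
            3≰1 (s≤s ())
    p∤g^ (suc e) p∣g^1+e with euclidsLemma g (g ^ e) prime p∣g^1+e
    ... | inj₁ p∣g   = g≢0 (∣∧<⇒≡0 q g p∣g g<p)
    ... | inj₂ p∣g^e = p∤g^ e p∣g^e

    G≢0 : ∀ e → ¬ (G e ≡ 0)
    G≢0 e G≡0 = p∤g^ e (m%n≡0⇒n∣m (g ^ e) p G≡0)

    G-period : ∀ s → G s ≡ 1 → ∀ b a → G (a + b * s) ≡ G a
    G-period s Gs≡1 zero    a = cong G (+-identityʳ a)
    G-period s Gs≡1 (suc b) a = begin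
      G (a + (s + b * s))        ≡⟨ cong G (+-comm a (s + b * s)) ⟩
      G ((s + b * s) + a)        ≡⟨ cong G (+-assoc s (b * s) a) ⟩
      G (s + (b * s + a))        ≡⟨ cong (λ z → G (s + z)) (+-comm (b * s) a) ⟩
      G (s + (a + b * s))        ≡⟨ G-+ s (a + b * s) ⟩
      (G s * G (a + b * s)) % p  ≡⟨ cong₂ (λ u v → (u * v) % p) Gs≡1 (G-period s Gs≡1 b a) ⟩
      (1 * G a) % p              ≡⟨ cong (_% p) (*-identityˡ (G a)) ⟩
      G a % p                    ≡⟨ G-% a ⟩
      G a                        ∎
      where open ≡-Reasoning

    G-mod-period : ∀ s .{{_ : NonZero s}} → G s ≡ 1 → ∀ e → G (e % s) ≡ G e
    G-mod-period s Gs≡1 e = trans (sym (G-period s Gs≡1 (e / s) (e % s))) (cong G (sym (m≡m%n+[m/n]*n e s)))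

    -- Every positive period is at least q: G takes all q nonzero values, while with
    -- period s it takes at most s values.
    period≥q : ∀ s → 1 ≤ s → G s ≡ 1 → q ≤ s
    period≥q s@(suc _) _ Gs≡1 = FinP.injective⇒≤ {f = reduce} reduce-inj
      where
      log : Fin q → ℕ
      log i = proj₁ (onto (suc (toℕ i)) (s≤s z≤n) (s≤s (FinP.toℕ<n i)))
      G-log : ∀ i → G (log i) ≡ suc (toℕ i)
      G-log i = proj₂ (onto (suc (toℕ i)) (s≤s z≤n) (s≤s (FinP.toℕ<n i)))
      reduce : Fin q → Fin s
      reduce i = fromℕ< (m%n<n (log i) s)
      reduce-inj : Injective _≡_ _≡_ reduce
      reduce-inj {i} {j} eq = FinP.toℕ-injective (suc-injective (begin
        suc (toℕ i)   ≡⟨ G-log i ⟨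
        G (log i)     ≡⟨ G-mod-period s Gs≡1 (log i) ⟨
        G (log i % s) ≡⟨ cong G (trans (sym (FinP.toℕ-fromℕ< _)) (trans (cong toℕ eq) (FinP.toℕ-fromℕ< _))) ⟩
        G (log j % s) ≡⟨ G-mod-period s Gs≡1 (log j) ⟩
        G (log j)     ≡⟨ G-log j ⟩
        suc (toℕ j)   ∎))
        where open ≡-Reasoning

    G-cancel : ∀ i j → i ≤ j → G i ≡ G j → G (j ∸ i) ≡ 1
    G-cancel i j i≤j Gi≡Gj = begin
      G (j ∸ i)       ≡⟨ G-% (j ∸ i) ⟨
      G (j ∸ i) % p   ≡⟨ *-cancelˡ-% q prime (G i) (G (j ∸ i)) 1 (λ Gi≡0 → G≢0 i (trans (sym (G-% i)) Gi≡0)) Gi·G≡Gi·1 ⟩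
      1 % p           ≡⟨ 1%p≡1 ⟩
      1               ∎
      where
      open ≡-Reasoning
      Gi·G≡Gi·1 : (G i * G (j ∸ i)) % p ≡ (G i * 1) % p
      Gi·G≡Gi·1 = begin
        (G i * G (j ∸ i)) % p ≡⟨ G-+ i (j ∸ i) ⟨
        G (i + (j ∸ i))       ≡⟨ cong G (m+[n∸m]≡n i≤j) ⟩
        G j                   ≡⟨ Gi≡Gj ⟨
        G i                   ≡⟨ G-% i ⟨
        G i % p               ≡⟨ cong (_% p) (*-identityʳ (G i)) ⟨
        (G i * 1) % p         ∎

    pred-G<q : ∀ e → pred (G e) < q
    pred-G<q e = ≤-pred (subst (_< p) (sym (suc-pred (G e) {{≢-nonZero (G≢0 e)}})) (G<p e))

    -- Fermat's little theorem for g: among G 0,…,G q (q + 1 values in the q nonzero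
    -- residues) two coincide, giving a period in (0, q]; by minimality it is q.
    G-q : G q ≡ 1
    G-q with FinP.pigeonhole (n<1+n q) (λ e → fromℕ< (pred-G<q (toℕ e)))
    ... | i , j , i<j , eq = subst (λ s → G s ≡ 1) j−i≡q (G-cancel (toℕ i) (toℕ j) (<⇒≤ i<j) Gi≡Gj)
      where
      Gi≡Gj : G (toℕ i) ≡ G (toℕ j)
      Gi≡Gj = begin
        G (toℕ i)               ≡⟨ suc-pred (G (toℕ i)) {{≢-nonZero (G≢0 (toℕ i))}} ⟨
        suc (pred (G (toℕ i)))  ≡⟨ cong suc (trans (sym (FinP.toℕ-fromℕ< _)) (trans (cong toℕ eq) (FinP.toℕ-fromℕ< _))) ⟩
        suc (pred (G (toℕ j)))  ≡⟨ suc-pred (G (toℕ j)) {{≢-nonZero (G≢0 (toℕ j))}} ⟩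
        G (toℕ j)               ∎
        where open ≡-Reasoning
      j−i≡q : toℕ j ∸ toℕ i ≡ q
      j−i≡q = ≤-antisym (≤-trans (m∸n≤m (toℕ j) (toℕ i)) (≤-pred (FinP.toℕ<n j)))
                        (period≥q _ (m<n⇒0<n∸m i<j) (G-cancel (toℕ i) (toℕ j) (<⇒≤ i<j) Gi≡Gj))

    G-periodic : ∀ b a → G (a + b * q) ≡ G a
    G-periodic = G-period q G-q

    -- Two distinct exponents below q with equal powers would give a period below q.
    no-short-period : ∀ {e f} → e < f → f < q → ¬ (G e ≡ G f)
    no-short-period {e} {f} e<f f<q Ge≡Gf = <-irrefl refl
      (≤-<-trans (period≥q (f ∸ e) (m<n⇒0<n∸m e<f) (G-cancel e f (<⇒≤ e<f) Ge≡Gf))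
                 (≤-<-trans (m∸n≤m f e) f<q))

    G-injective : ∀ e f → e < q → f < q → G e ≡ G f → e ≡ f
    G-injective e f e<q f<q Ge≡Gf with <-cmp e f
    ... | tri≈ _ e≡f _ = e≡f
    ... | tri< e<f _ _ = ⊥-elim (no-short-period e<f f<q Ge≡Gf)
    ... | tri> _ _ f<e = ⊥-elim (no-short-period f<e e<q (sym Ge≡Gf))

module Cosets where

  open import Data.Nat using (ℕ; suc; _+_; _*_; _∸_; _%_; _/_; _≤_; _<_; _^_; NonZero)
  open import Data.Nat.Properties
  open import Data.Nat.DivMod
  open import Data.Nat.Primality using (Prime)
  import Data.Nat.Tactic.RingSolver as ℕ-Solver
  open import Data.Integer as ℤ using (ℤ; +_; 0ℤ; 1ℤ)
  import Data.Integer.Properties as ℤP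
  open import Data.Product using (∃-syntax; _×_; _,_; proj₁; proj₂)
  open import Data.Sum using (_⊎_; inj₁; inj₂)
  open import Relation.Binary.PropositionalEquality
  open import Relation.Nullary using (¬_; yes; no)
  open FiniteSums
  open Residues using (%-*ˡ; %-*ʳ)

  module Indicators (n k g : ℕ) .{{_ : NonZero n}} .{{_ : NonZero k}} (prime : Prime (suc (n * k)))
           (2<p : 2 < suc (n * k)) (g<p : g < suc (n * k))
           (onto : ∀ x → 1 ≤ x → x < suc (n * k) → ∃[ e ] (g ^ e) % suc (n * k) ≡ x) where

    open PrimitiveRoot.Powers (n * k) g prime 2<p g<p onto public

    InCoset : ℕ → ℕ → Set
    InCoset r x = ∃[ α ] α < k × x ≡ G (α * n + r)

    -- χ r x = #{α < k : x = G (α n + r)}, which is the indicator of X_r.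
    χ : ℕ → ℕ → ℤ
    χ r x = Sum k (λ α → δ x (G (α * n + r)))

    exponent< : ∀ α r → α < k → r < n → α * n + r < n * k
    exponent< α r α<k r<n = begin-strict
      α * n + r  <⟨ +-monoʳ-< (α * n) r<n ⟩
      α * n + n  ≡⟨ +-comm (α * n) n ⟩
      suc α * n  ≤⟨ *-monoˡ-≤ n α<k ⟩
      k * n      ≡⟨ *-comm k n ⟩
      n * k      ∎
      where open ≤-Reasoning

    exponent-injective : ∀ α β r s → α < k → β < k → r < n → s < n →
                         G (α * n + r) ≡ G (β * n + s) → α ≡ β × r ≡ s
    exponent-injective α β r s α<k β<k r<n s<n eq = α≡β , r≡s
      where
      exp≡ : α * n + r ≡ β * n + s
      exp≡ = G-injective _ _ (exponent< α r α<k r<n) (exponent< β s β<k s<n) eq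
      r≡s : r ≡ s
      r≡s = begin
        r                ≡⟨ m<n⇒m%n≡m r<n ⟨
        r % n            ≡⟨ [m+kn]%n≡m%n r α n ⟨
        (r + α * n) % n  ≡⟨ cong (_% n) (trans (+-comm r (α * n)) (trans exp≡ (+-comm (β * n) s))) ⟩
        (s + β * n) % n  ≡⟨ [m+kn]%n≡m%n s β n ⟩
        s % n            ≡⟨ m<n⇒m%n≡m s<n ⟩
        s                ∎
        where open ≡-Reasoning
      α≡β : α ≡ β
      α≡β = *-cancelʳ-≡ α β n (+-cancelʳ-≡ r (α * n) (β * n) (trans exp≡ (cong (λ u → β * n + u) (sym r≡s))))

    coset-disjoint : ∀ r s x → r < n → s < n → InCoset r x → InCoset s x → r ≡ s
    coset-disjoint r s x r<n s<n (α , α<k , x≡) (β , β<k , x≡′) =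
      proj₂ (exponent-injective α β r s α<k β<k r<n s<n (trans (sym x≡) x≡′))

    χ-member : ∀ r x → r < n → InCoset r x → χ r x ≡ 1ℤ
    χ-member r x r<n (α₀ , α₀<k , refl) = begin
      Sum k (λ α → δ (G (α₀ * n + r)) (G (α * n + r)))  ≡⟨ Sum-cong k term ⟩
      Sum k (λ α → δ α α₀ ℤ.* 1ℤ)                         ≡⟨ Sum-δ k α₀ (λ _ → 1ℤ) α₀<k ⟩
      1ℤ                                                  ∎
      where
      open ≡-Reasoning
      term : ∀ α → α < k → δ (G (α₀ * n + r)) (G (α * n + r)) ≡ δ α α₀ ℤ.* 1ℤ
      term α α<k with α ≟ α₀
      ... | yes refl = trans (δ-diag (G (α * n + r))) (sym (trans (ℤP.*-identityʳ (δ α α)) (δ-diag α)))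
      ... | no  α≢α₀ = trans (δ-off _ _ (λ eq → α≢α₀ (sym (proj₁ (exponent-injective α₀ α r r α₀<k α<k r<n r<n eq)))))
                             (sym (trans (ℤP.*-identityʳ (δ α α₀)) (δ-off α α₀ α≢α₀)))

    χ≢0⇒member : ∀ r x → ¬ (χ r x ≡ 0ℤ) → InCoset r x
    χ≢0⇒member r x χ≢0 with Sum≢0⇒term≢0 k _ χ≢0
    ... | α , α<k , δ≢0 = α , α<k , δ≢0⇒≡ x (G (α * n + r)) δ≢0

    χ≡1⇒member : ∀ r x → χ r x ≡ 1ℤ → InCoset r x
    χ≡1⇒member r x χ≡1 = χ≢0⇒member r x (λ χ≡0 → 1≢0 (trans (sym χ≡1) χ≡0))
      where 1≢0 : ¬ (1ℤ ≡ 0ℤ)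
            1≢0 ()

    χ-01 : ∀ r x → r < n → χ r x ≡ 0ℤ ⊎ χ r x ≡ 1ℤ
    χ-01 r x r<n with χ r x ℤP.≟ 0ℤ
    ... | yes χ≡0 = inj₁ χ≡0
    ... | no  χ≢0 = inj₂ (χ-member r x r<n (χ≢0⇒member r x χ≢0))

    χ-ext : ∀ r x y → r < n → (InCoset r x → InCoset r y) → (InCoset r y → InCoset r x) → χ r x ≡ χ r y
    χ-ext r x y r<n x⇒y y⇒x with χ-01 r x r<n | χ-01 r y r<n
    ... | inj₂ χx≡1 | _         = trans χx≡1 (sym (χ-member r y r<n (x⇒y (χ≡1⇒member r x χx≡1))))
    ... | _         | inj₂ χy≡1 = trans (χ-member r x r<n (y⇒x (χ≡1⇒member r y χy≡1))) (sym χy≡1)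
    ... | inj₁ χx≡0 | inj₁ χy≡0 = trans χx≡0 (sym χy≡0)

    Sum-χ : ∀ r → Sum (suc (n * k)) (χ r) ≡ + k
    Sum-χ r = begin
      Sum p (λ x → Sum k (λ α → δ x (G (α * n + r))))  ≡⟨ Sum-comm p k (λ x α → δ x (G (α * n + r))) ⟩
      Sum k (λ α → Sum p (λ x → δ x (G (α * n + r))))  ≡⟨ Sum-cong k (λ α _ → one-hit α) ⟩
      Sum k (λ _ → 1ℤ)                                 ≡⟨ Sum-const k 1ℤ ⟩
      + k ℤ.* 1ℤ                                       ≡⟨ ℤP.*-identityʳ (+ k) ⟩
      + k                                              ∎
      where
      open ≡-Reasoning
      one-hit : ∀ α → Sum p (λ x → δ x (G (α * n + r))) ≡ 1ℤ
      one-hit α = trans (Sum-cong p (λ x _ → sym (ℤP.*-identityʳ (δ x (G (α * n + r))))))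
                        (Sum-δ p (G (α * n + r)) (λ _ → 1ℤ) (G<p (α * n + r)))

    coset-closed : ∀ r c z → InCoset r z → InCoset r ((G (c * n) * z) % p)
    coset-closed r c z (α , α<k , refl) = s % k , m%n<n s k , (begin
      (G (c * n) * G (α * n + r)) % p  ≡⟨ G-+ (c * n) (α * n + r) ⟨
      G (c * n + (α * n + r))          ≡⟨ cong G (trans (sym (+-assoc (c * n) (α * n) r)) (cong (_+ r) (sym (*-distribʳ-+ n c α)))) ⟩
      G (s * n + r)                    ≡⟨ cong (λ u → G (u * n + r)) (m≡m%n+[m/n]*n s k) ⟩
      G ((s % k + s / k * k) * n + r)  ≡⟨ cong G (regroup (s % k) (s / k) n k r) ⟩
      G ((s % k * n + r) + s / k * (n * k)) ≡⟨ G-periodic (s / k) (s % k * n + r) ⟩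
      G (s % k * n + r)                ∎)
      where
      open ≡-Reasoning
      s : ℕ
      s = c + α
      regroup : ∀ a b n k r → (a + b * k) * n + r ≡ (a * n + r) + b * (n * k)
      regroup = ℕ-Solver.solve-∀

    -- Conversely, if G (β n)·z ∈ X_r then z ∈ X_r: multiply by G ((k − β) n) = G (β n)⁻¹.
    coset-closed⁻¹ : ∀ r β z → β < k → z < p → InCoset r ((G (β * n) * z) % p) → InCoset r z
    coset-closed⁻¹ r β z β<k z<p z′∈X = subst (InCoset r) undo (coset-closed r (k ∸ β) _ z′∈X)
      where
      open ≡-Reasoning
      a b : ℕ
      a = G ((k ∸ β) * n)
      b = G (β * n)
      undo : (a * ((b * z) % p)) % p ≡ z
      undo = begin
        (a * ((b * z) % p)) % p   ≡⟨ %-*ʳ p a (b * z) ⟩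
        (a * (b * z)) % p         ≡⟨ cong (_% p) (*-assoc a b z) ⟨
        ((a * b) * z) % p         ≡⟨ %-*ˡ p (a * b) z ⟨
        (((a * b) % p) * z) % p   ≡⟨ cong (λ u → (u * z) % p) (G-+ ((k ∸ β) * n) (β * n)) ⟨
        (G ((k ∸ β) * n + β * n) * z) % p
          ≡⟨ cong (λ u → (G u * z) % p) (trans (sym (*-distribʳ-+ n (k ∸ β) β)) (trans (cong (_* n) (m∸n+n≡m (<⇒≤ β<k))) (*-comm k n))) ⟩
        (G (n * k) * z) % p       ≡⟨ cong (λ u → (u * z) % p) G-q ⟩
        (1 * z) % p               ≡⟨ cong (_% p) (*-identityˡ z) ⟩
        z % p                     ≡⟨ m<n⇒m%n≡m z<p ⟩
        z                         ∎

    χ-invariant : ∀ r → r < n → ∀ h → χ 0 h ≡ 1ℤ → ∀ z → z < p → χ r ((h * z) % p) ≡ χ r z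
    χ-invariant r r<n h χ₀h≡1 z z<p with χ≡1⇒member 0 h χ₀h≡1
    ... | β , β<k , refl rewrite +-identityʳ (β * n) =
      χ-ext r _ z r<n (coset-closed⁻¹ r β z β<k z<p) (coset-closed r β z)

    χ₀-nonzero : ∀ h → h < p → χ 0 h ≡ 1ℤ → ¬ (h % p ≡ 0)
    χ₀-nonzero h h<p χ₀h≡1 h%p≡0 with χ≡1⇒member 0 h χ₀h≡1
    ... | β , _ , refl = G≢0 (β * n + 0) (trans (sym (m<n⇒m%n≡m h<p)) h%p≡0)

module Inequalities where

  open import Data.Nat as ℕ using (ℕ; z≤n)
  open import Data.Integer using (ℤ; +_; -[1+_]; 0ℤ; 1ℤ; _+_; _*_; _-_; -_; _≤_; +≤+)
  import Data.Integer.Properties as ℤP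
  open import Data.Integer.Tactic.RingSolver using (solve-∀)
  open import Data.Sum using (_⊎_; inj₁; inj₂)
  open import Relation.Binary.PropositionalEquality
  open FiniteSums

  sq : ℤ → ℤ
  sq x = x * x

  sq-nonneg : ∀ x → 0ℤ ≤ sq x
  sq-nonneg (+ n)    = subst (0ℤ ≤_) (ℤP.pos-* n n) (+≤+ z≤n)
  sq-nonneg -[1+ n ] = +≤+ z≤n

  01-idem : ∀ {x} → x ≡ 0ℤ ⊎ x ≡ 1ℤ → x * x ≡ x
  01-idem (inj₁ refl) = refl
  01-idem (inj₂ refl) = refl

  half-nonneg : ∀ e → 0ℤ ≤ e + e → 0ℤ ≤ e
  half-nonneg e 0≤2e = ℤP.*-cancelˡ-≤-pos 0ℤ e (+ 2) (subst (0ℤ ≤_) (double e) 0≤2e)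
    where
    double : ∀ e → e + e ≡ + 2 * e
    double = solve-∀

  -- Cauchy–Schwarz with 0/1 weights: (Σ w v)² ≤ (Σ w)(Σ w v²).  It follows from
  -- Lagrange's identity Σ_{y,z} w_y w_z (v_y − v_z)² = 2[(Σ w)(Σ w v²) − (Σ w v)²].
  cauchy-schwarz : ∀ n (w v : ℕ → ℤ) → (∀ x → x ℕ.< n → w x ≡ 0ℤ ⊎ w x ≡ 1ℤ) →
                   sq (Sum n (λ y → w y * v y)) ≤ Sum n w * Sum n (λ y → w y * sq (v y))
  cauchy-schwarz n w v w-01 = ℤP.0≤i-j⇒j≤i (half-nonneg _ (subst (0ℤ ≤_) lagrange 0≤D))
    where
    wv wv² : ℕ → ℤ
    wv  y = w y * v y
    wv² y = w y * sq (v y)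
    D : ℤ
    D = Sum n (λ y → Sum n (λ z → w y * w z * sq (v y - v z)))
    0≤D : 0ℤ ≤ D
    0≤D = Sum-nonneg n _ (λ y y<n → Sum-nonneg n _ (λ z z<n → 0≤term y z y<n z<n))
      where
      0≤term : ∀ y z → y ℕ.< n → z ℕ.< n → 0ℤ ≤ w y * w z * sq (v y - v z)
      0≤term y z y<n z<n with w-01 y y<n | w-01 z z<n
      ... | inj₁ wy≡0 | _         rewrite wy≡0 = ℤP.≤-refl
      ... | inj₂ wy≡1 | inj₁ wz≡0 rewrite wy≡1 | wz≡0 = ℤP.≤-refl
      ... | inj₂ wy≡1 | inj₂ wz≡1 rewrite wy≡1 | wz≡1 = subst (0ℤ ≤_) (sym (ℤP.*-identityˡ _)) (sq-nonneg (v y - v z))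
    expand : ∀ y z → w y * w z * sq (v y - v z) ≡ wv² y * w z + (w y * wv² z + (- + 2) * (wv y * wv z))
    expand y z = ring (w y) (w z) (v y) (v z)
      where
      ring : ∀ a b c d → a * b * ((c - d) * (c - d)) ≡ a * (c * c) * b + (a * (b * (d * d)) + (- + 2) * (a * c * (b * d)))
      ring = solve-∀
    lagrange : D ≡ (Sum n w * Sum n wv² - sq (Sum n wv)) + (Sum n w * Sum n wv² - sq (Sum n wv))
    lagrange = begin
      D
        ≡⟨ Sum-cong₂ n (λ y z _ _ → expand y z) ⟩
      Sum n (λ y → Sum n (λ z → wv² y * w z + (w y * wv² z + (- + 2) * (wv y * wv z))))
        ≡⟨ Sum-cong n (λ y _ → trans (Sum-+ n _ _) (cong₂ _+_ (Sum-*ˡ n (wv² y) w)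
             (trans (Sum-+ n _ _) (cong₂ _+_ (Sum-*ˡ n (w y) wv²)
               (trans (Sum-*ˡ n (- + 2) _) (cong ((- + 2) *_) (Sum-*ˡ n (wv y) wv))))))) ⟩
      Sum n (λ y → wv² y * Sum n w + (w y * Sum n wv² + (- + 2) * (wv y * Sum n wv)))
        ≡⟨ trans (Sum-+ n _ _) (cong₂ _+_ (Sum-*ʳ n (Sum n w) wv²)
             (trans (Sum-+ n _ _) (cong₂ _+_ (Sum-*ʳ n (Sum n wv²) w)
               (trans (Sum-*ˡ n (- + 2) _) (cong ((- + 2) *_) (Sum-*ʳ n (Sum n wv) wv)))))) ⟩
      Sum n wv² * Sum n w + (Sum n w * Sum n wv² + (- + 2) * (Sum n wv * Sum n wv))
        ≡⟨ ring (Sum n wv²) (Sum n w) (Sum n wv) ⟩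
      (Sum n w * Sum n wv² - sq (Sum n wv)) + (Sum n w * Sum n wv² - sq (Sum n wv)) ∎
      where
      open ≡-Reasoning
      ring : ∀ a b c → a * b + (b * a + (- + 2) * (c * c)) ≡ (b * a - c * c) + (b * a - c * c)
      ring = solve-∀

-- With F = p·1_H − k
-- (which has sum 0) and Φ y = Σ_t F t · C (t + y),
--   Σ_y H y Φ y = pN − k³,  where N = #{(y,t) ∈ H² : t + y ∈ C};
--   (Σ_y H y Φ y)² ≤ k Σ_y Φ y²                                   (Cauchy–Schwarz);
--   k Σ_y Φ y² ≤ Σ_{h ∈ 𝔽_p} Σ_y ψ_h(y)²,  ψ_h y = Σ_t F t · C (h t + y),
--     because ψ_h is a rearrangement of Φ for each of the k elements h ∈ H;
--   Σ_h Σ_y ψ_h(y)² = k(p − k) Σ_t F t² = k(p − k) · pk(p − k),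
--     because Σ_h Σ_y C (h t + y) C (h t′ + y) = k² + [t = t′]·k(p − k).
module SecondMoment where

  open import Data.Nat as ℕ using (ℕ; suc; _%_)
  import Data.Nat.Properties as ℕP
  open import Data.Nat.DivMod using (m%n<n; m<n⇒m%n≡m; n%n≡0; %-remove-+ˡ)
  open import Data.Nat.Divisibility using (n∣m*n)
  open import Data.Nat.Primality using (Prime)
  import Data.Nat.Tactic.RingSolver as ℕ-Solver
  open import Data.Integer using (ℤ; +_; 0ℤ; 1ℤ; _+_; _*_; _-_; -_; _≤_)
  import Data.Integer.Properties as ℤP
  open import Data.Integer.Tactic.RingSolver using (solve-∀)
  open import Data.Product using (∃-syntax; _×_; _,_)
  open import Data.Sum using (_⊎_; inj₁; inj₂)
  open import Relation.Binary.PropositionalEquality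
  open import Relation.Nullary using (¬_; yes; no)
  open import Data.Empty using (⊥-elim)
  open FiniteSums
  open Inequalities
  open Residues using (%-+ʳ; %-+ˡ; %-*ʳ; +-cancelˡ-%; Sum-shift; Sum-affine; Sum-dilate)

  module Bound (q k : ℕ) (prime : Prime (suc q)) (H C : ℕ → ℤ)
    (H-01 : ∀ x → x ℕ.< suc q → H x ≡ 0ℤ ⊎ H x ≡ 1ℤ)
    (C-01 : ∀ x → x ℕ.< suc q → C x ≡ 0ℤ ⊎ C x ≡ 1ℤ)
    (H-size : Sum (suc q) H ≡ + k) (C-size : Sum (suc q) C ≡ + k)
    (H-nonzero : ∀ h → h ℕ.< suc q → H h ≡ 1ℤ → ¬ (h % suc q ≡ 0))
    (C-invariant : ∀ h → h ℕ.< suc q → H h ≡ 1ℤ → ∀ z → z ℕ.< suc q → C ((h ℕ.* z) % suc q) ≡ C z)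
    where

    p : ℕ
    p = suc q

    S : (ℕ → ℤ) → ℤ
    S = Sum p

    P K : ℤ
    P = + p
    K = + k

    F : ℕ → ℤ
    F t = P * H t - K

    Φ : ℕ → ℤ
    Φ y = S (λ t → F t * C ((t ℕ.+ y) % p))

    ψ : ℕ → ℕ → ℤ
    ψ h y = S (λ t → F t * C ((h ℕ.* t ℕ.+ y) % p))

    N : ℤ
    N = S (λ y → S (λ t → H y * H t * C ((t ℕ.+ y) % p)))

    -- L = k(p − k), the variance factor of the correlations of C.
    L : ℤ
    L = P * K - K * K

    Sum-C-shift : ∀ y → S (λ t → C ((t ℕ.+ y) % p)) ≡ K
    Sum-C-shift y = trans (Sum-cong p (λ t _ → cong (λ z → C (z % p)) (ℕP.+-comm t y))) (trans (Sum-shift q y C) C-size)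

    F-sum : S F ≡ 0ℤ
    F-sum = begin
      S F                                ≡⟨ Sum-cong p (λ t _ → ring P K (H t)) ⟩
      S (λ t → P * H t + (- K) * 1ℤ)     ≡⟨ Sum-lin p P (- K) H (λ _ → 1ℤ) ⟩
      P * S H + (- K) * S (λ _ → 1ℤ)     ≡⟨ cong₂ (λ a b → P * a + (- K) * b) H-size (Sum-const p 1ℤ) ⟩
      P * K + (- K) * (P * 1ℤ)           ≡⟨ ring′ P K ⟩
      0ℤ                                 ∎
      where
      open ≡-Reasoning
      ring : ∀ P K h → P * h - K ≡ P * h + (- K) * 1ℤ
      ring = solve-∀
      ring′ : ∀ P K → P * K + (- K) * (P * 1ℤ) ≡ 0ℤ
      ring′ = solve-∀

    F-square-sum : S (λ t → sq (F t)) ≡ P * K * (P - K)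
    F-square-sum = begin
      S (λ t → sq (F t))                                   ≡⟨ Sum-cong p term ⟩
      S (λ t → (P * P - + 2 * P * K) * H t + K * K * 1ℤ)   ≡⟨ Sum-lin p (P * P - + 2 * P * K) (K * K) H (λ _ → 1ℤ) ⟩
      (P * P - + 2 * P * K) * S H + K * K * S (λ _ → 1ℤ)   ≡⟨ cong₂ (λ a b → (P * P - + 2 * P * K) * a + K * K * b) H-size (Sum-const p 1ℤ) ⟩
      (P * P - + 2 * P * K) * K + K * K * (P * 1ℤ)         ≡⟨ ring′ P K ⟩
      P * K * (P - K)                                      ∎
      where
      open ≡-Reasoning
      -- Since H t ∈ {0, 1}, the quadratic term P² H t² collapses to P² H t.
      term : ∀ t → t ℕ.< p → sq (F t) ≡ (P * P - + 2 * P * K) * H t + K * K * 1ℤ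
      term t t<p = begin
        sq (F t)                                                           ≡⟨ expand P K (H t) ⟩
        (P * P - + 2 * P * K) * H t + K * K * 1ℤ + P * P * (H t * H t - H t)
          ≡⟨ cong (λ z → (P * P - + 2 * P * K) * H t + K * K * 1ℤ + P * P * (z - H t)) (01-idem (H-01 t t<p)) ⟩
        (P * P - + 2 * P * K) * H t + K * K * 1ℤ + P * P * (H t - H t)     ≡⟨ collapse P K (H t) ⟩
        (P * P - + 2 * P * K) * H t + K * K * 1ℤ                           ∎
        where
        expand : ∀ P K h → (P * h - K) * (P * h - K) ≡ (P * P - + 2 * P * K) * h + K * K * 1ℤ + P * P * (h * h - h)
        expand = solve-∀
        collapse : ∀ P K h → (P * P - + 2 * P * K) * h + K * K * 1ℤ + P * P * (h - h) ≡ (P * P - + 2 * P * K) * h + K * K * 1ℤ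
        collapse = solve-∀
      ring′ : ∀ P K → (P * P - + 2 * P * K) * K + K * K * (P * 1ℤ) ≡ P * K * (P - K)
      ring′ = solve-∀

    Σ-HΦ : S (λ y → H y * Φ y) ≡ P * N - K * K * K
    Σ-HΦ = begin
      S (λ y → H y * Φ y)
        ≡⟨ Sum-cong p (λ y _ → row y) ⟩
      S (λ y → P * S (λ t → H y * H t * C ((t ℕ.+ y) % p)) + (- K) * (H y * K))
        ≡⟨ Sum-lin p P (- K) _ _ ⟩
      P * N + (- K) * S (λ y → H y * K)
        ≡⟨ cong (λ z → P * N + (- K) * z) (trans (Sum-*ʳ p K H) (cong (_* K) H-size)) ⟩
      P * N + (- K) * (K * K)
        ≡⟨ ring P N K ⟩
      P * N - K * K * K ∎
      where
      open ≡-Reasoning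
      ring : ∀ a b c → a * b + (- c) * (c * c) ≡ a * b - c * c * c
      ring = solve-∀
      distribute : ∀ P K a b c → a * ((P * b - K) * c) ≡ P * (a * b * c) + (- K) * (a * c)
      distribute = solve-∀
      row : ∀ y → H y * Φ y ≡ P * S (λ t → H y * H t * C ((t ℕ.+ y) % p)) + (- K) * (H y * K)
      row y = begin
        H y * Φ y
          ≡⟨ Sum-*ˡ p (H y) _ ⟨
        S (λ t → H y * (F t * C ((t ℕ.+ y) % p)))
          ≡⟨ Sum-cong p (λ t _ → distribute P K (H y) (H t) (C ((t ℕ.+ y) % p))) ⟩
        S (λ t → P * (H y * H t * C ((t ℕ.+ y) % p)) + (- K) * (H y * C ((t ℕ.+ y) % p)))
          ≡⟨ Sum-lin p P (- K) _ _ ⟩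
        P * S (λ t → H y * H t * C ((t ℕ.+ y) % p)) + (- K) * S (λ t → H y * C ((t ℕ.+ y) % p))
          ≡⟨ cong (λ z → P * S (λ t → H y * H t * C ((t ℕ.+ y) % p)) + (- K) * z)
                  (trans (Sum-*ˡ p (H y) _) (cong (H y *_) (Sum-C-shift y))) ⟩
        P * S (λ t → H y * H t * C ((t ℕ.+ y) % p)) + (- K) * (H y * K) ∎

    -- Cauchy–Schwarz, with weights H and then dropping them.
    Σ-HΦ-bound : sq (S (λ y → H y * Φ y)) ≤ K * S (λ y → sq (Φ y))
    Σ-HΦ-bound = ℤP.≤-trans (cauchy-schwarz p H Φ H-01)
      (subst (λ z → z * S (λ y → H y * sq (Φ y)) ≤ K * S (λ y → sq (Φ y))) (sym H-size)
             (ℤP.*-monoˡ-≤-nonNeg K (Sum-mono p drop-weight)))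
      where
      drop-weight : ∀ y → y ℕ.< p → H y * sq (Φ y) ≤ sq (Φ y)
      drop-weight y y<p with H-01 y y<p
      ... | inj₁ Hy≡0 rewrite Hy≡0 = sq-nonneg (Φ y)
      ... | inj₂ Hy≡1 rewrite Hy≡1 = ℤP.≤-reflexive (ℤP.*-identityˡ _)

    -- For h ∈ H, ψ_h is Φ up to the bijection y ↦ h y, since C (h (t + y)) = C (t + y).
    ψ-rearranges-Φ : ∀ h → h ℕ.< p → H h ≡ 1ℤ → S (λ y → sq (ψ h y)) ≡ S (λ y → sq (Φ y))
    ψ-rearranges-Φ h h<p Hh≡1 =
      trans (sym (Sum-dilate q prime h (H-nonzero h h<p Hh≡1) (λ z → sq (ψ h z))))
            (Sum-cong p (λ y _ → cong sq (Sum-cong p (λ t _ → cong (F t *_) (C-scaled t y)))))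
      where
      C-scaled : ∀ t y → C ((h ℕ.* t ℕ.+ (h ℕ.* y) % p) % p) ≡ C ((t ℕ.+ y) % p)
      C-scaled t y = trans
        (cong C (trans (%-+ʳ p (h ℕ.* t) (h ℕ.* y))
                  (trans (cong (_% p) (sym (ℕP.*-distribˡ-+ h t y))) (sym (%-*ʳ p h (t ℕ.+ y))))))
        (C-invariant h h<p Hh≡1 ((t ℕ.+ y) % p) (m%n<n (t ℕ.+ y) p))

    Q : ℕ → ℤ
    Q h = S (λ y → sq (ψ h y))

    -- Averaging over the k elements of H and adding the nonnegative terms h ∉ H.
    averaging : K * S (λ y → sq (Φ y)) ≤ S Q
    averaging = subst (_≤ S Q) (trans (Sum-*ʳ p _ H) (cong (_* S (λ y → sq (Φ y))) H-size)) (Sum-mono p term)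
      where
      term : ∀ h → h ℕ.< p → H h * S (λ y → sq (Φ y)) ≤ Q h
      term h h<p with H-01 h h<p
      ... | inj₁ Hh≡0 rewrite Hh≡0 = Sum-nonneg p _ (λ y _ → sq-nonneg (ψ h y))
      ... | inj₂ Hh≡1 rewrite Hh≡1 = ℤP.≤-reflexive (trans (ℤP.*-identityˡ _) (sym (ψ-rearranges-Φ h h<p Hh≡1)))

    Corr : ℕ → ℕ → ℤ
    Corr t t′ = S (λ h → S (λ y → C ((h ℕ.* t ℕ.+ y) % p) * C ((h ℕ.* t′ ℕ.+ y) % p)))

    Corr-diagonal : ∀ t → Corr t t ≡ P * K
    Corr-diagonal t = begin
      Corr t t                                      ≡⟨ Sum-cong₂ p (λ h y _ _ → 01-idem (C-01 _ (m%n<n (h ℕ.* t ℕ.+ y) p))) ⟩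
      S (λ h → S (λ y → C ((h ℕ.* t ℕ.+ y) % p)))   ≡⟨ Sum-cong p (λ h _ → trans (Sum-shift q (h ℕ.* t) C) C-size) ⟩
      S (λ _ → K)                                   ≡⟨ Sum-const p K ⟩
      P * K                                         ∎
      where open ≡-Reasoning

    -- For t ≠ t′ put d = t′ − t ≢ 0; then z = h t + y and h ↦ z + h d are bijections.
    Corr-off-diagonal : ∀ t t′ → t ℕ.< p → t′ ℕ.< p → ¬ (t′ ≡ t) → Corr t t′ ≡ K * K
    Corr-off-diagonal t t′ t<p t′<p t′≢t = begin
      Corr t t′                                      ≡⟨ Sum-cong p (λ h _ → substitute h) ⟩
      S (λ h → S (λ z → C z * C ((z ℕ.+ h ℕ.* d) % p)))  ≡⟨ Sum-comm p p _ ⟩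
      S (λ z → S (λ h → C z * C ((z ℕ.+ h ℕ.* d) % p)))
        ≡⟨ Sum-cong p (λ z _ → trans (Sum-*ˡ p (C z) _) (cong (C z *_) (trans (Sum-affine q prime z d d≢0 C) C-size))) ⟩
      S (λ z → C z * K)                              ≡⟨ trans (Sum-*ʳ p K C) (cong (_* K) C-size) ⟩
      K * K                                          ∎
      where
      open ≡-Reasoning
      d : ℕ
      d = t′ ℕ.+ (p ℕ.∸ t)
      t+[p−t]≡p : t ℕ.+ (p ℕ.∸ t) ≡ p
      t+[p−t]≡p = ℕP.m+[n∸m]≡n (ℕP.<⇒≤ t<p)
      d≢0 : ¬ (d % p ≡ 0)
      d≢0 d≡0 = t′≢t (trans (sym (m<n⇒m%n≡m t′<p)) (trans t′≡t (m<n⇒m%n≡m t<p)))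
        where
        t′≡t : t′ % p ≡ t % p
        t′≡t = +-cancelˡ-% q (p ℕ.∸ t) t′ t
          (trans (cong (_% p) (ℕP.+-comm (p ℕ.∸ t) t′))
            (trans d≡0 (trans (sym (n%n≡0 p)) (cong (_% p) (trans (sym t+[p−t]≡p) (ℕP.+-comm t (p ℕ.∸ t)))))))
      regroup : ∀ h y → (h ℕ.* t ℕ.+ y) ℕ.+ h ℕ.* d ≡ (h ℕ.* t′ ℕ.+ y) ℕ.+ h ℕ.* p
      regroup h y = trans (ring h t y t′ (p ℕ.∸ t)) (cong (λ z → (h ℕ.* t′ ℕ.+ y) ℕ.+ h ℕ.* z) t+[p−t]≡p)
        where
        ring : ∀ h t y t′ e → (h ℕ.* t ℕ.+ y) ℕ.+ h ℕ.* (t′ ℕ.+ e) ≡ (h ℕ.* t′ ℕ.+ y) ℕ.+ h ℕ.* (t ℕ.+ e)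
        ring = ℕ-Solver.solve-∀
      h-t′-y : ∀ h y → (h ℕ.* t′ ℕ.+ y) % p ≡ ((h ℕ.* t ℕ.+ y) % p ℕ.+ h ℕ.* d) % p
      h-t′-y h y = sym (begin
        ((h ℕ.* t ℕ.+ y) % p ℕ.+ h ℕ.* d) % p  ≡⟨ %-+ˡ p (h ℕ.* t ℕ.+ y) (h ℕ.* d) ⟩
        ((h ℕ.* t ℕ.+ y) ℕ.+ h ℕ.* d) % p      ≡⟨ cong (_% p) (regroup h y) ⟩
        ((h ℕ.* t′ ℕ.+ y) ℕ.+ h ℕ.* p) % p     ≡⟨ cong (_% p) (ℕP.+-comm (h ℕ.* t′ ℕ.+ y) (h ℕ.* p)) ⟩
        (h ℕ.* p ℕ.+ (h ℕ.* t′ ℕ.+ y)) % p     ≡⟨ %-remove-+ˡ (h ℕ.* t′ ℕ.+ y) (n∣m*n h) ⟩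
        (h ℕ.* t′ ℕ.+ y) % p                   ∎)
      substitute : ∀ h → S (λ y → C ((h ℕ.* t ℕ.+ y) % p) * C ((h ℕ.* t′ ℕ.+ y) % p))
                       ≡ S (λ z → C z * C ((z ℕ.+ h ℕ.* d) % p))
      substitute h = trans (Sum-cong p (λ y _ → cong (λ w → C ((h ℕ.* t ℕ.+ y) % p) * C w) (h-t′-y h y)))
                           (Sum-shift q (h ℕ.* t) (λ z → C z * C ((z ℕ.+ h ℕ.* d) % p)))

    Corr≡ : ∀ t t′ → t ℕ.< p → t′ ℕ.< p → Corr t t′ ≡ K * K + δ t′ t * L
    Corr≡ t t′ t<p t′<p with t′ ℕP.≟ t
    ... | yes refl = trans (Corr-diagonal t) (trans (split P K) (cong (λ z → K * K + z * L) (sym (δ-diag t))))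
      where
      split : ∀ P K → P * K ≡ K * K + 1ℤ * (P * K - K * K)
      split = solve-∀
    ... | no t′≢t = trans (Corr-off-diagonal t t′ t<p t′<p t′≢t)
                          (sym (trans (cong (λ z → K * K + z * L) (δ-off t′ t t′≢t)) (ℤP.+-identityʳ (K * K))))

    -- Expanding the squares and using the correlations, only the diagonal t = t′ survives (F has sum 0).
    total-energy : S Q ≡ L * S (λ t → sq (F t))
    total-energy = begin
      S (λ h → S (λ y → sq (ψ h y)))
        ≡⟨ Sum-cong₂ p (λ h y _ _ → expand-square h y) ⟩
      S (λ h → S (λ y → S (λ t → S (λ t′ → E h y t t′))))
        ≡⟨ Sum-cong p (λ h _ → Sum-comm p p (λ y t → S (λ t′ → E h y t t′))) ⟩
      S (λ h → S (λ t → S (λ y → S (λ t′ → E h y t t′))))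
        ≡⟨ Sum-cong₂ p (λ h t _ _ → Sum-comm p p (λ y t′ → E h y t t′)) ⟩
      S (λ h → S (λ t → S (λ t′ → S (λ y → E h y t t′))))
        ≡⟨ Sum-comm p p (λ h t → S (λ t′ → S (λ y → E h y t t′))) ⟩
      S (λ t → S (λ h → S (λ t′ → S (λ y → E h y t t′))))
        ≡⟨ Sum-cong p (λ t _ → Sum-comm p p (λ h t′ → S (λ y → E h y t t′))) ⟩
      S (λ t → S (λ t′ → S (λ h → S (λ y → E h y t t′))))
        ≡⟨ Sum-cong₂ p (λ t t′ _ _ → trans (Sum-cong p (λ h _ → Sum-*ˡ p (F t * F t′) _)) (Sum-*ˡ p (F t * F t′) _)) ⟩
      S (λ t → S (λ t′ → F t * F t′ * Corr t t′))
        ≡⟨ Sum-cong₂ p (λ t t′ t<p t′<p → trans (cong (F t * F t′ *_) (Corr≡ t t′ t<p t′<p)) (ring (F t) (F t′) (K * K) L (δ t′ t))) ⟩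
      S (λ t → S (λ t′ → (F t * (K * K)) * F t′ + L * (δ t′ t * (F t * F t′))))
        ≡⟨ Sum-cong p (λ t t<p → trans (Sum-lin p (F t * (K * K)) L F _)
                                   (cong₂ (λ a b → (F t * (K * K)) * a + L * b) F-sum (Sum-δ p t (λ t′ → F t * F t′) t<p))) ⟩
      S (λ t → (F t * (K * K)) * 0ℤ + L * (F t * F t))
        ≡⟨ Sum-cong p (λ t _ → trans (cong (_+ L * (F t * F t)) (ℤP.*-zeroʳ (F t * (K * K)))) (ℤP.+-identityˡ _)) ⟩
      S (λ t → L * sq (F t))
        ≡⟨ Sum-*ˡ p L _ ⟩
      L * S (λ t → sq (F t)) ∎
      where
      open ≡-Reasoning
      E : ℕ → ℕ → ℕ → ℕ → ℤ
      E h y t t′ = F t * F t′ * (C ((h ℕ.* t ℕ.+ y) % p) * C ((h ℕ.* t′ ℕ.+ y) % p))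
      expand-square : ∀ h y → sq (ψ h y) ≡ S (λ t → S (λ t′ → E h y t t′))
      expand-square h y = trans (sym (Sum-product p _ _))
        (Sum-cong₂ p (λ t t′ _ _ → swap (F t) (F t′) (C ((h ℕ.* t ℕ.+ y) % p)) (C ((h ℕ.* t′ ℕ.+ y) % p))))
        where
        swap : ∀ a b c d → a * c * (b * d) ≡ a * b * (c * d)
        swap = solve-∀
      ring : ∀ a b c l d → a * b * (c + d * l) ≡ (a * c) * b + l * (d * (a * b))
      ring = solve-∀

    second-moment-bound : sq (P * N - K * K * K) ≤ L * (P * K * (P - K))
    second-moment-bound = subst₂ _≤_ (cong sq Σ-HΦ) (trans total-energy (cong (L *_) F-square-sum))
                                 (ℤP.≤-trans Σ-HΦ-bound averaging)

    -- Numerical gap between the two sides of (★) when N = 0.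
    Gap : Set
    Gap = k ℕ.* (p ℕ.∸ k) ℕ.* (p ℕ.* k ℕ.* (p ℕ.∸ k)) ℕ.< k ℕ.* k ℕ.* k ℕ.* (k ℕ.* k ℕ.* k)

    -- With N = 0, (★) would read k⁶ ≤ k(p − k)·pk(p − k) in ℕ.
    N≢0 : k ℕ.≤ p → Gap → ¬ (N ≡ 0ℤ)
    N≢0 k≤p gap N≡0 = ℕP.<⇒≱ gap (ℤP.drop‿+≤+ (subst₂ _≤_ lhs rhs second-moment-bound))
      where
      open ≡-Reasoning
      k³ : K * K * K ≡ + (k ℕ.* k ℕ.* k)
      k³ = trans (cong (_* K) (sym (ℤP.pos-* k k))) (sym (ℤP.pos-* (k ℕ.* k) k))
      lhs : sq (P * N - K * K * K) ≡ + (k ℕ.* k ℕ.* k ℕ.* (k ℕ.* k ℕ.* k))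
      lhs = begin
        sq (P * N - K * K * K)          ≡⟨ cong (λ z → sq (P * z - K * K * K)) N≡0 ⟩
        sq (P * 0ℤ - K * K * K)         ≡⟨ ring P K ⟩
        K * K * K * (K * K * K)         ≡⟨ cong₂ _*_ k³ k³ ⟩
        + (k ℕ.* k ℕ.* k) * + (k ℕ.* k ℕ.* k) ≡⟨ ℤP.pos-* (k ℕ.* k ℕ.* k) (k ℕ.* k ℕ.* k) ⟨
        + (k ℕ.* k ℕ.* k ℕ.* (k ℕ.* k ℕ.* k)) ∎
        where
        ring : ∀ P K → (P * 0ℤ - K * K * K) * (P * 0ℤ - K * K * K) ≡ K * K * K * (K * K * K)
        ring = solve-∀
      P−K : P - K ≡ + (p ℕ.∸ k)
      P−K = trans (ℤP.m-n≡m⊖n p k) (ℤP.⊖-≥ k≤p)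
      rhs : L * (P * K * (P - K)) ≡ + (k ℕ.* (p ℕ.∸ k) ℕ.* (p ℕ.* k ℕ.* (p ℕ.∸ k)))
      rhs = begin
        L * (P * K * (P - K))                 ≡⟨ ring P K ⟩
        K * (P - K) * (P * K * (P - K))       ≡⟨ cong (λ z → K * z * (P * K * z)) P−K ⟩
        K * + (p ℕ.∸ k) * (P * K * + (p ℕ.∸ k))
          ≡⟨ cong₂ _*_ (sym (ℤP.pos-* k (p ℕ.∸ k))) (trans (cong (_* + (p ℕ.∸ k)) (sym (ℤP.pos-* p k))) (sym (ℤP.pos-* (p ℕ.* k) (p ℕ.∸ k)))) ⟩
        + (k ℕ.* (p ℕ.∸ k)) * + (p ℕ.* k ℕ.* (p ℕ.∸ k))
          ≡⟨ ℤP.pos-* (k ℕ.* (p ℕ.∸ k)) (p ℕ.* k ℕ.* (p ℕ.∸ k)) ⟨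
        + (k ℕ.* (p ℕ.∸ k) ℕ.* (p ℕ.* k ℕ.* (p ℕ.∸ k))) ∎
        where
        ring : ∀ P K → (P * K - K * K) * (P * K * (P - K)) ≡ K * (P - K) * (P * K * (P - K))
        ring = solve-∀

    factors-one : ∀ {a b c} → a ≡ 0ℤ ⊎ a ≡ 1ℤ → b ≡ 0ℤ ⊎ b ≡ 1ℤ → c ≡ 0ℤ ⊎ c ≡ 1ℤ →
                  ¬ (a * b * c ≡ 0ℤ) → a ≡ 1ℤ × b ≡ 1ℤ × c ≡ 1ℤ
    factors-one (inj₁ refl) _           _           abc≢0 = ⊥-elim (abc≢0 refl)
    factors-one (inj₂ refl) (inj₁ refl) _           abc≢0 = ⊥-elim (abc≢0 refl)
    factors-one (inj₂ refl) (inj₂ refl) (inj₁ refl) abc≢0 = ⊥-elim (abc≢0 refl)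
    factors-one (inj₂ refl) (inj₂ refl) (inj₂ refl) _     = refl , refl , refl

    SumInC : Set
    SumInC = ∃[ t ] ∃[ y ] H t ≡ 1ℤ × H y ≡ 1ℤ × C ((t ℕ.+ y) % p) ≡ 1ℤ

    sum-in-C : k ℕ.≤ p → Gap → SumInC
    sum-in-C k≤p gap = from-row (Sum≢0⇒term≢0 p (λ y → S (λ t → H y * H t * C ((t ℕ.+ y) % p))) (N≢0 k≤p gap))
      where
      from-term : ∀ y → y ℕ.< p → ∃[ t ] t ℕ.< p × ¬ (H y * H t * C ((t ℕ.+ y) % p) ≡ 0ℤ) → SumInC
      from-term y y<p (t , t<p , term≢0)
        with factors-one (H-01 y y<p) (H-01 t t<p) (C-01 _ (m%n<n (t ℕ.+ y) p)) term≢0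
      ... | Hy≡1 , Ht≡1 , C≡1 = t , y , Ht≡1 , Hy≡1 , C≡1
      from-row : ∃[ y ] y ℕ.< p × ¬ (S (λ t → H y * H t * C ((t ℕ.+ y) % p)) ≡ 0ℤ) → SumInC
      from-row (y , y<p , row≢0) = from-term y y<p (Sum≢0⇒term≢0 p (λ t → H y * H t * C ((t ℕ.+ y) % p)) row≢0)

-- The numerical gap: for p = nk + 1 > n⁴ + 5 the right-hand side of (★) is below k⁶.
-- Indeed k > n³, hence n²p = n³k + n² < k², and k(p − k)·pk(p − k) ≤ k⁴ · n²p < k⁶.
module Numerical where

  open import Data.Nat using (ℕ; suc; s≤s; _+_; _*_; _∸_; _^_; _≤_; _<_; >-nonZero)
  open import Data.Nat.Properties
  import Data.Nat.Tactic.RingSolver as ℕ-Solver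
  open import Relation.Binary.PropositionalEquality

  n⁴≡ : ∀ n → n ^ 4 ≡ n * (n * n * n)
  n⁴≡ n = ring n
    where
    ring : ∀ n → n * (n * (n * (n * 1))) ≡ n * (n * n * n)
    ring = ℕ-Solver.solve-∀

  large⇒n³<k : ∀ n k → n ^ 4 + 5 < suc (n * k) → n * n * n < k
  large⇒n³<k n k large = ≰⇒> (λ k≤n³ → <-irrefl refl (<-≤-trans large (begin
    suc (n * k)             ≤⟨ s≤s (*-monoʳ-≤ n k≤n³) ⟩
    suc (n * (n * n * n))   ≡⟨ cong suc (n⁴≡ n) ⟨
    suc (n ^ 4)             ≤⟨ s≤s (m≤m+n (n ^ 4) 4) ⟩
    suc (n ^ 4 + 4)         ≡⟨ +-suc (n ^ 4) 4 ⟨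
    n ^ 4 + 5               ∎)))
    where open ≤-Reasoning

  n²p<k² : ∀ n k → 1 ≤ n → n ^ 4 + 5 < suc (n * k) → n * n * suc (n * k) < k * k
  n²p<k² n k 1≤n large = begin-strict
    n * n * suc (n * k)          ≡⟨ expand n k ⟩
    n * n * n * k + n * n        ≤⟨ +-monoʳ-≤ (n * n * n * k) (≤-trans (≤-reflexive (sym (*-identityʳ (n * n)))) (*-monoʳ-≤ (n * n) 1≤n)) ⟩
    n * n * n * k + n * n * n    <⟨ +-monoʳ-< (n * n * n * k) n³<k ⟩
    n * n * n * k + k            ≡⟨ +-comm (n * n * n * k) k ⟩
    suc (n * n * n) * k          ≤⟨ *-monoˡ-≤ k n³<k ⟩
    k * k                        ∎
    where
    open ≤-Reasoning
    n³<k : n * n * n < k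
    n³<k = large⇒n³<k n k large
    expand : ∀ n k → n * n * suc (n * k) ≡ n * n * n * k + n * n
    expand = ℕ-Solver.solve-∀

  numerical-gap : ∀ n k → 1 ≤ n → 1 ≤ k → n ^ 4 + 5 < suc (n * k) →
                  k * (suc (n * k) ∸ k) * (suc (n * k) * k * (suc (n * k) ∸ k)) < k * k * k * (k * k * k)
  numerical-gap n k 1≤n 1≤k large = begin-strict
    k * (p ∸ k) * (p * k * (p ∸ k))   ≤⟨ *-mono-≤ (*-monoʳ-≤ k p−k≤nk) (*-monoʳ-≤ (p * k) p−k≤nk) ⟩
    k * (n * k) * (p * k * (n * k))   ≡⟨ regroup n k p ⟩
    k⁴ * (n * n * p)                  <⟨ *-monoʳ-< k⁴ {{>-nonZero 1≤k⁴}} (n²p<k² n k 1≤n large) ⟩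
    k⁴ * (k * k)                      ≡⟨ regroup′ k ⟩
    k * k * k * (k * k * k)           ∎
    where
    open ≤-Reasoning
    p k⁴ : ℕ
    p = suc (n * k)
    k⁴ = k * k * k * k
    p−k≤nk : p ∸ k ≤ n * k
    p−k≤nk = ∸-monoʳ-≤ p 1≤k
    1≤k⁴ : 1 ≤ k⁴
    1≤k⁴ = *-mono-≤ (*-mono-≤ (*-mono-≤ 1≤k 1≤k) 1≤k) 1≤k
    regroup : ∀ n k p → k * (n * k) * (p * k * (n * k)) ≡ k * k * k * k * (n * n * p)
    regroup = ℕ-Solver.solve-∀
    regroup′ : ∀ k → k * k * k * k * (k * k) ≡ k * k * k * (k * k * k)
    regroup′ = ℕ-Solver.solve-∀

module SumsOfCosets where

  open import Defs
  open import Data.Nat as ℕ using (ℕ; zero; suc; z≤n; s≤s; _+_; _*_; _^_; _≤_; _<_; _%_; NonZero; >-nonZero⁻¹)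
  open import Data.Nat.Properties using (≤-trans; <⇒≤; m≤n+m; m≤n*m; n≤1+n)
  open import Data.Nat.DivMod using (m<n⇒m%n≡m; m%n<n)
  open import Data.Nat.Primality using (Prime)
  open import Data.Product using (∃-syntax; _×_; _,_; proj₁; proj₂)
  open import Relation.Binary.PropositionalEquality
  open import Relation.Nullary using (¬_)
  open Numerical using (numerical-gap)

  modN-small : ∀ {r n} → r < n → modN r n ≡ r
  modN-small {n = suc n} r<n = m<n⇒m%n≡m r<n

  module _ (n k g : ℕ) .{{_ : NonZero n}} .{{_ : NonZero k}} (prime : Prime (suc (n * k)))
           (large : n ^ 4 + 5 < suc (n * k)) (root : IsPrimitiveRoot (suc (n * k)) g) where

    private
      2<p : 2 < suc (n * k)
      2<p = ≤-trans (s≤s (s≤s (s≤s z≤n))) (≤-trans (m≤n+m 5 (n ^ 4)) (<⇒≤ large))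

    open Cosets.Indicators n k g prime 2<p (proj₁ root) (proj₂ root)

    X : ℕ → ℕ → Set
    X = Coset p g n k

    InCoset⇒X : ∀ r x → r < n → InCoset r x → X r x
    InCoset⇒X r x r<n (α , α<k , x≡) = α , α<k , trans x≡ (cong (λ i → G (α * n + i)) (sym (modN-small r<n)))

    X⇒InCoset : ∀ r x → r < n → X r x → InCoset r x
    X⇒InCoset r x r<n (α , α<k , x≡) = α , α<k , trans x≡ (cong (λ i → G (α * n + i)) (modN-small r<n))

    0<n : 0 < n
    0<n = >-nonZero⁻¹ n

    X₀+X₀-meets : ∀ r → r < n → ∃[ t ] ∃[ y ] InCoset 0 t × InCoset 0 y × InCoset r ((t + y) % p)
    X₀+X₀-meets r r<n = members (sum-in-C k≤p (numerical-gap n k 0<n (>-nonZero⁻¹ k) large))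
      where
      k≤p : k ≤ p
      k≤p = ≤-trans (m≤n*m k n) (n≤1+n (n * k))
      open SecondMoment.Bound (n * k) k prime (χ 0) (χ r)
             (λ x _ → χ-01 0 x 0<n) (λ x _ → χ-01 r x r<n) (Sum-χ 0) (Sum-χ r)
             χ₀-nonzero (λ h _ χ₀h≡1 → χ-invariant r r<n h χ₀h≡1)
             using (SumInC; sum-in-C)
      members : SumInC → ∃[ t ] ∃[ y ] InCoset 0 t × InCoset 0 y × InCoset r ((t + y) % p)
      members (t , y , χt≡1 , χy≡1 , χt+y≡1) =
        t , y , χ≡1⇒member 0 t χt≡1 , χ≡1⇒member 0 y χy≡1 , χ≡1⇒member r _ χt+y≡1

    X₀+X₀-avoids-no-coset : ∀ r → r < n →
      ¬ (∀ x → x < p → SumSet p (X 0) (X 0) x → ∃[ j ] j < n × ¬ (j ≡ r) × X j x)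
    X₀+X₀-avoids-no-coset r r<n avoids = refute (X₀+X₀-meets r r<n)
      where
      refute : ¬ (∃[ t ] ∃[ y ] InCoset 0 t × InCoset 0 y × InCoset r ((t + y) % p))
      refute (t , y , t∈X₀ , y∈X₀ , t+y∈Xr) = other-coset
        (avoids ((t + y) % p) (m%n<n (t + y) p) (t , y , InCoset⇒X 0 t 0<n t∈X₀ , InCoset⇒X 0 y 0<n y∈X₀ , refl))
        where
        other-coset : ¬ (∃[ j ] j < n × ¬ (j ≡ r) × X j ((t + y) % p))
        other-coset (j , j<n , j≢r , t+y∈Xj) = j≢r (coset-disjoint j r _ j<n r<n (X⇒InCoset j _ j<n t+y∈Xj) t+y∈Xr)


open import Defs
open import Data.Nat using (ℕ; _+_; _*_; _^_; _≤_; _<_)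
open import Data.Nat.Divisibility using (_∣_)
open import Data.Nat.Primality using (Prime)
open import Data.Product using (_×_)
open import Relation.Nullary using (¬_)
open import Relation.Binary.PropositionalEquality using (_≡_)

open import Data.Nat using (zero; suc; z≤n; s≤s)
open import Data.Nat.Divisibility using (divides)
open import Data.Nat.Properties using (+-comm; m<m+n)
open import Data.Product using (_,_; proj₁)
open import Relation.Binary.PropositionalEquality using (refl; sym; trans; subst)
open import Data.Empty using (⊥-elim)
open import Function.Bundles using (Equivalence)
open SumsOfCosets using (X₀+X₀-avoids-no-coset; modN-small)

-- k odd excludes k = 0 and m ≥ 1 excludes m = 0, so n = 2m and k are nonzero.
-- Condition (1) at i = 0 makes X₀ + X₀ avoid X₀ (Ramsey) or X_m (Anti-Ramsey),
-- which X₀+X₀-avoids-no-coset rules out.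
mainTheorem1 : (k m p g : ℕ) → ¬ (2 ∣ k) → 1 ≤ m → p ≡ (2 * m) * k + 1 → Prime p
    → (2 * m) ^ 4 + 5 < p → IsPrimitiveRoot p g
    → ¬ DirectedRamsey p g m k × ¬ DirectedAntiRamsey p g m k
mainTheorem1 zero    _       _ _ k-odd _ _ _ _ _ = ⊥-elim (k-odd (divides 0 refl))
mainTheorem1 (suc k) zero    _ _ _ () _ _ _ _
mainTheorem1 (suc k) (suc m) p g _ _ p≡ p-prime large root
  rewrite trans p≡ (+-comm (2 * suc m * suc k) 1) = not-ramsey , not-anti-ramsey
  where
  n : ℕ
  n = 2 * suc m
  0<n : 0 < n
  0<n = s≤s z≤n
  m<n : suc m < n
  m<n = m<m+n (suc m) (s≤s z≤n)
  not-ramsey : ¬ DirectedRamsey (suc (n * suc k)) g (suc m) (suc k)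
  not-ramsey ramsey = X₀+X₀-avoids-no-coset n (suc k) g p-prime large root 0 0<n (λ x x<p → Equivalence.to (proj₁ (ramsey 0 0<n) x x<p))
  not-anti-ramsey : ¬ DirectedAntiRamsey (suc (n * suc k)) g (suc m) (suc k)
  not-anti-ramsey anti = X₀+X₀-avoids-no-coset n (suc k) g p-prime large root
    (modN (suc m) n) (subst (_< n) (sym (modN-small m<n)) m<n) (λ x x<p → Equivalence.to (proj₁ (anti 0 0<n) x x<p))
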